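{- Let $d \ge 1$ and $0 \le k \le d$ be integers, and let $a, c \in \mathbb{Z}$ with $a$ coprime to $d$. Let $g_{a,c}(x) = a(x-c) \bmod d \in \{0,\ldots,d-1\}$. Let $Q_{a,c} = \{q_1,\ldots,q_m\} \subset \mathbb{Z}$ be any ruler for the distance set $\{a(0-c), a(1-c), \ldots, a(k-c)\}$, i.e. for every $s \in \{0,\ldots,k\}$ there exist $i,j$ with $q_i - q_j = a(s-c)$, and let $R_{a,c} = \{r_1,\ldots,r_m\}$ where $r_i = q_i \bmod d \in \{0,\ldots,d-1\}$. Then: (1) $R_{a,c}$ is a cyclic ruler for $\{g_{a,c}(0),\ldots,g_{a,c}(k)\}$: for every $s \in \{0,\ldots,k\}$ there exist $r_i, r_j \in R_{a,c}$ with either $r_i - r_j = g_{a,c}(s)$ or $r_i - r_j = d - g_{a,c}(s)$. (2) There exists a ruler $Q_{a,c}$ for the distance set $\{a(0-c), a(1-c), \ldots, a(k-c)\}$ with $|Q_{a,c}| = O(\sqrt{k})$, and correspondingly $|R_{a,c}| = O(\sqrt{k})$ (with an absolute implied constant).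
   Context: A ruler for a set $S$ of integer distances is a set $Q$ of integers such that every $s\in S$ equals $q - q'$ for some $q,q'\in Q$. The set $R_{a,c}$ obtained by reducing such a $Q_{a,c}$ modulo $d$ is called a random ultra-sparse ruler (when $a,c$ are random). -}

module Defs where

open import Data.Nat as ℕ using (ℕ; NonZero)
open import Data.Integer using (ℤ; +_; _-_; _*_)
open import Data.Integer.DivMod using (_%ℕ_)
open import Data.List using (List; map)
open import Data.List.Membership.Propositional using (_∈_)
open import Data.Product using (∃; ∃-syntax; _×_)
open import Data.Sum using (_⊎_)
open import Relation.Binary.PropositionalEquality using (_≡_)

dist : ℤ → ℤ → ℕ → ℤ
dist a c s = a * (+ s - c)

IsRuler : ℤ → ℤ → ℕ → List ℤ → Set
IsRuler a c k Q =
  ∀ (s : ℕ) → s ℕ.≤ k → ∃[ qi ] ∃[ qj ] (qi ∈ Q × qj ∈ Q × qi - qj ≡ dist a c s)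

g : (d : ℕ) → .{{NonZero d}} → ℤ → ℤ → ℕ → ℕ
g d a c x = dist a c x %ℕ d

reduce : (d : ℕ) → .{{NonZero d}} → List ℤ → List ℕ
reduce d Q = map (λ q → q %ℕ d) Q

IsCyclicRuler : (d : ℕ) → .{{NonZero d}} → ℤ → ℤ → ℕ → List ℕ → Set
IsCyclicRuler d a c k R =
  ∀ (s : ℕ) → s ℕ.≤ k → ∃[ ri ] ∃[ rj ]
    (ri ∈ R × rj ∈ R ×
      ((+ ri - + rj ≡ + g d a c s) ⊎ (+ ri - + rj ≡ + d - + g d a c s)))

-- Reducing mod d respects differences, so q_i - q_j = a(s - c) gives r_i - r_j ≡ g(s) (mod d);
-- since |r_i - r_j| < d, either r_i - r_j = g(s) or r_j - r_i = d - g(s).  For (2), pick m with k + 1 ≤ m² ≤ 4(k + 1): the baby-step giant-step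
-- set {a(tm - c) : t < m} ∪ {-au : u < m} has 2m elements and realises a(s - c) with s = tm + u.
module Submission where

open import Defs
open import Data.Nat as ℕ using (ℕ; NonZero; suc; zero; _≤_; _<_; _≤?_)
import Data.Nat.Properties as ℕ
open import Data.Nat.DivMod using (_/_; _%_; m≡m%n+[m/n]*n; m%n<n; m<n*o⇒m/o<n; m<n⇒m%n≡m)
open import Data.Nat.Divisibility using (n∣m⇒m%n≡0)
open import Data.Integer using (ℤ; +_; -_; _+_; _-_; _*_; ∣_∣)
open import Data.Integer.Properties
  using (+-injective; pos-+; m-n≡m⊖n; ⊖-≥; ∣m⊝n∣≤m⊔n; ∣i∣≡0⇒i≡0; i-j≡0⇒i≡j)
open import Data.Integer.DivMod using (_%ℕ_; _/ℕ_; a≡a%ℕn+[a/ℕn]*n; n%ℕd<d)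
open import Data.Integer.Divisibility.Signed using (_∣_; divides; ∣⇒∣ᵤ; ∣-refl; ∣m∣n⇒∣m+n; ∣m∣n⇒∣m-n)
open import Data.Integer.Tactic.RingSolver using (solve-∀)
import Data.Nat.Tactic.RingSolver as ℕ-Solver
open import Data.Integer.Coprimality using (Coprime)
open import Data.List using (List; length; map; _++_; upTo)
open import Data.List.Properties using (length-map; length-++; length-upTo)
open import Data.List.Membership.Propositional.Properties using (∈-map⁺; ∈-++⁺ˡ; ∈-++⁺ʳ; ∈-upTo⁺)
open import Data.Product using (∃-syntax; _×_; _,_)
open import Data.Sum using (inj₁; inj₂)
open import Relation.Nullary using (yes; no)
open import Relation.Binary.PropositionalEquality using (_≡_; refl; sym; trans; cong; cong₂; subst; module ≡-Reasoning)

+-∸ : ∀ {m n} → n ≤ m → + (m ℕ.∸ n) ≡ + m - + n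
+-∸ {m} {n} n≤m = sym (trans (m-n≡m⊖n m n) (⊖-≥ n≤m))

+d∣i-i%ℕd : ∀ i d .{{_ : NonZero d}} → + d ∣ i - + (i %ℕ d)
+d∣i-i%ℕd i d = divides (i /ℕ d) (begin
  i - + (i %ℕ d)                             ≡⟨ cong (_- + (i %ℕ d)) (a≡a%ℕn+[a/ℕn]*n i d) ⟩
  + (i %ℕ d) + (i /ℕ d) * + d - + (i %ℕ d) ≡⟨ cancel (+ (i %ℕ d)) ((i /ℕ d) * + d) ⟩
  (i /ℕ d) * + d                             ∎)
  where
  open ≡-Reasoning
  cancel : ∀ r t → r + t - r ≡ t
  cancel = solve-∀

%ℕ-difference-congruent : ∀ d .{{_ : NonZero d}} x y {D} → x - y ≡ D →
  + d ∣ (+ (x %ℕ d) - + (y %ℕ d)) - + (D %ℕ d)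
%ℕ-difference-congruent d x y refl =
  subst (+ d ∣_) (regroup x y (+ (x %ℕ d)) (+ (y %ℕ d)) (+ ((x - y) %ℕ d)))
    (∣m∣n⇒∣m+n (∣m∣n⇒∣m-n (+d∣i-i%ℕd (x - y) d) (+d∣i-i%ℕd x d)) (+d∣i-i%ℕd y d))
  where
  regroup : ∀ x y rx ry r → ((x - y) - r) - (x - rx) + (y - ry) ≡ (rx - ry) - r
  regroup = solve-∀

congruent-residues⇒≡ : ∀ {d u v} .{{_ : NonZero d}} → u < d → v < d → + d ∣ + u - + v → u ≡ v
congruent-residues⇒≡ {d} {u} {v} u<d v<d d∣u-v =
  +-injective (i-j≡0⇒i≡j (+ u) (+ v) (∣i∣≡0⇒i≡0 ∣u-v∣≡0))
  where
  ∣u-v∣<d : ∣ + u - + v ∣ < d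
  ∣u-v∣<d = ℕ.≤-trans (ℕ.s≤s (subst (ℕ._≤ u ℕ.⊔ v) (cong ∣_∣ (sym (m-n≡m⊖n u v))) (∣m⊝n∣≤m⊔n u v)))
                      (ℕ.⊔-lub u<d v<d)
  ∣u-v∣≡0 : ∣ + u - + v ∣ ≡ 0
  ∣u-v∣≡0 = trans (sym (m<n⇒m%n≡m ∣u-v∣<d)) (n∣m⇒m%n≡0 _ d (∣⇒∣ᵤ d∣u-v))

residue-difference-≡ : ∀ {d rx ry r} .{{_ : NonZero d}} → rx < d → r < d → ry ≤ rx →
  + d ∣ (+ rx - + ry) - + r → + rx - + ry ≡ + r
residue-difference-≡ {d} {rx} {ry} {r} rx<d r<d ry≤rx d∣δ =
  trans (sym (+-∸ ry≤rx)) (cong +_ (congruent-residues⇒≡ e<d r<d d∣e-r))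
  where
  e<d : rx ℕ.∸ ry < d
  e<d = ℕ.≤-<-trans (ℕ.m∸n≤m rx ry) rx<d
  d∣e-r : + d ∣ + (rx ℕ.∸ ry) - + r
  d∣e-r = subst (λ i → + d ∣ i - + r) (sym (+-∸ ry≤rx)) d∣δ

-- For rx < ry the residue of rx - ry is d - (ry - rx), which lies in (0, d).
residue-difference-≡-complement : ∀ {d rx ry r} .{{_ : NonZero d}} → ry < d → r < d → rx < ry →
  + d ∣ (+ rx - + ry) - + r → + ry - + rx ≡ + d - + r
residue-difference-≡-complement {d} {rx} {ry} {r} ry<d r<d rx<ry d∣δ = begin
  + ry - + rx                 ≡⟨ double-complement (+ d) (+ ry - + rx) ⟩
  + d - (+ d - (+ ry - + rx)) ≡⟨ cong (_-_ (+ d)) (sym +u≡d-e) ⟩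
  + d - + u                   ≡⟨ cong (λ n → + d - + n) u≡r ⟩
  + d - + r                   ∎
  where
  open ≡-Reasoning
  e = ry ℕ.∸ rx
  u = d ℕ.∸ e
  +u≡d-e : + u ≡ + d - (+ ry - + rx)
  +u≡d-e = trans (+-∸ (ℕ.≤-trans (ℕ.m∸n≤m ry rx) (ℕ.<⇒≤ ry<d))) (cong (_-_ (+ d)) (+-∸ (ℕ.<⇒≤ rx<ry)))
  shift : ∀ D X Y R → (D - (Y - X)) - R ≡ D + ((X - Y) - R)
  shift = solve-∀
  double-complement : ∀ D E → E ≡ D - (D - E)
  double-complement = solve-∀
  u≡r : u ≡ r
  u≡r = congruent-residues⇒≡ (ℕ.∸-monoʳ-< (ℕ.m<n⇒0<n∸m rx<ry) (ℕ.≤-trans (ℕ.m∸n≤m ry rx) (ℕ.<⇒≤ ry<d))) r<d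
    (subst (+ d ∣_) (trans (sym (shift (+ d) (+ rx) (+ ry) (+ r))) (cong (_- + r) (sym +u≡d-e)))
      (∣m∣n⇒∣m+n ∣-refl d∣δ))

reduce-isCyclicRuler : ∀ d .{{_ : NonZero d}} k a c (Q : List ℤ) →
  IsRuler a c k Q → IsCyclicRuler d a c k (reduce d Q)
reduce-isCyclicRuler d k a c Q ruler s s≤k with ruler s s≤k
... | x , y , x∈Q , y∈Q , x-y≡D with y %ℕ d ≤? x %ℕ d
...   | yes ry≤rx = x %ℕ d , y %ℕ d , ∈-map⁺ _ x∈Q , ∈-map⁺ _ y∈Q ,
  inj₁ (residue-difference-≡ (n%ℕd<d x d) (n%ℕd<d (dist a c s) d) ry≤rx
                             (%ℕ-difference-congruent d x y x-y≡D))
...   | no ry≰rx = y %ℕ d , x %ℕ d , ∈-map⁺ _ y∈Q , ∈-map⁺ _ x∈Q ,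
  inj₂ (residue-difference-≡-complement (n%ℕd<d y d) (n%ℕd<d (dist a c s) d) (ℕ.≰⇒> ry≰rx)
                                        (%ℕ-difference-congruent d x y x-y≡D))

m≤m*m : ∀ m → m ≤ m ℕ.* m
m≤m*m zero    = ℕ.z≤n
m≤m*m (suc m) = ℕ.m≤m*n (suc m) (suc m)

[1+m]²≤4[1+m²] : ∀ m → suc m ℕ.* suc m ≤ 4 ℕ.* suc (m ℕ.* m)
[1+m]²≤4[1+m²] m = begin
  suc m ℕ.* suc m                         ≡⟨ expand m ⟩
  suc (m ℕ.+ m ℕ.+ m ℕ.* m)               ≤⟨ ℕ.s≤s (ℕ.+-monoˡ-≤ (m ℕ.* m) (ℕ.+-mono-≤ (m≤m*m m) (m≤m*m m))) ⟩
  suc (m² ℕ.+ m² ℕ.+ m²)                  ≤⟨ ℕ.m≤m+n _ (3 ℕ.+ m²) ⟩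
  suc (m² ℕ.+ m² ℕ.+ m²) ℕ.+ (3 ℕ.+ m²)   ≡⟨ regroup m² ⟩
  4 ℕ.* suc m²                            ∎
  where
  open ℕ.≤-Reasoning
  m² = m ℕ.* m
  expand : ∀ m → suc m ℕ.* suc m ≡ suc (m ℕ.+ m ℕ.+ m ℕ.* m)
  expand = ℕ-Solver.solve-∀
  regroup : ∀ x → suc (x ℕ.+ x ℕ.+ x) ℕ.+ (3 ℕ.+ x) ≡ 4 ℕ.* suc x
  regroup = ℕ-Solver.solve-∀

∃-square-between : ∀ n → ∃[ m ] (n ≤ m ℕ.* m × m ℕ.* m ≤ 4 ℕ.* n)
∃-square-between zero = 0 , ℕ.z≤n , ℕ.z≤n
∃-square-between (suc n) with ∃-square-between n
... | m , n≤m² , m²≤4n with suc n ≤? m ℕ.* m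
...   | yes 1+n≤m² = m , 1+n≤m² , ℕ.≤-trans m²≤4n (ℕ.*-monoʳ-≤ 4 (ℕ.n≤1+n n))
...   | no 1+n≰m² with ℕ.≤-antisym n≤m² (ℕ.≤-pred (ℕ.≰⇒> 1+n≰m²))
...     | refl = suc m , ℕ.*-mono-< (ℕ.n<1+n m) (ℕ.n<1+n m) , [1+m]²≤4[1+m²] m

giantStep : ℤ → ℤ → ℕ → ℕ → ℤ
giantStep a c m t = a * (+ (t ℕ.* m) - c)

babyStep : ℤ → ℕ → ℤ
babyStep a u = - (a * + u)

babyGiantRuler : ℤ → ℤ → ℕ → List ℤ
babyGiantRuler a c m = map (giantStep a c m) (upTo m) ++ map (babyStep a) (upTo m)

giantStep-babyStep : ∀ a c m t u → giantStep a c m t - babyStep a u ≡ dist a c (u ℕ.+ t ℕ.* m)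
giantStep-babyStep a c m t u = begin
  a * (+ (t ℕ.* m) - c) - - (a * + u) ≡⟨ merge a c (+ (t ℕ.* m)) (+ u) ⟩
  a * ((+ u + + (t ℕ.* m)) - c)       ≡⟨ cong (λ i → a * (i - c)) (pos-+ u (t ℕ.* m)) ⟨
  a * (+ (u ℕ.+ t ℕ.* m) - c)         ∎
  where
  open ≡-Reasoning
  merge : ∀ a c T U → a * (T - c) - - (a * U) ≡ a * ((U + T) - c)
  merge = solve-∀

babyGiantRuler-isRuler : ∀ a c k m → k < m ℕ.* m → IsRuler a c k (babyGiantRuler a c m)
babyGiantRuler-isRuler a c k m@(suc _) k<m² s s≤k =
  giantStep a c m (s / m) , babyStep a (s % m) ,
  ∈-++⁺ˡ {ys = map (babyStep a) (upTo m)} (∈-map⁺ (giantStep a c m) (∈-upTo⁺ s/m<m)) ,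
  ∈-++⁺ʳ (map (giantStep a c m) (upTo m)) (∈-map⁺ (babyStep a) (∈-upTo⁺ (m%n<n s m))) ,
  trans (giantStep-babyStep a c m (s / m) (s % m)) (cong (dist a c) (sym (m≡m%n+[m/n]*n s m)))
  where
  s/m<m : s / m < m
  s/m<m = m<n*o⇒m/o<n (ℕ.≤-<-trans s≤k k<m²)

length-babyGiantRuler : ∀ a c m → length (babyGiantRuler a c m) ≡ m ℕ.+ m
length-babyGiantRuler a c m = begin
  length (babyGiantRuler a c m)                                      ≡⟨ length-++ (map (giantStep a c m) (upTo m)) ⟩
  length (map (giantStep a c m) (upTo m)) ℕ.+ length (map (babyStep a) (upTo m))
    ≡⟨ cong₂ ℕ._+_ (length-map _ (upTo m)) (length-map _ (upTo m)) ⟩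
  length (upTo m) ℕ.+ length (upTo m)                                ≡⟨ cong₂ ℕ._+_ (length-upTo m) (length-upTo m) ⟩
  m ℕ.+ m                                                            ∎
  where open ≡-Reasoning

small-ruler : ∀ a c k → ∃[ Q ] (IsRuler a c k Q × length Q ℕ.* length Q ≤ 16 ℕ.* suc k)
small-ruler a c k with ∃-square-between (suc k)
... | m , 1+k≤m² , m²≤4[1+k] = babyGiantRuler a c m , babyGiantRuler-isRuler a c k m 1+k≤m² , size
  where
  open ℕ.≤-Reasoning
  doubling : ∀ m → (m ℕ.+ m) ℕ.* (m ℕ.+ m) ≡ 4 ℕ.* (m ℕ.* m)
  doubling = ℕ-Solver.solve-∀
  L = length (babyGiantRuler a c m)
  size : L ℕ.* L ≤ 16 ℕ.* suc k
  size = begin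
    L ℕ.* L                 ≡⟨ cong₂ ℕ._*_ (length-babyGiantRuler a c m) (length-babyGiantRuler a c m) ⟩
    (m ℕ.+ m) ℕ.* (m ℕ.+ m) ≡⟨ doubling m ⟩
    4 ℕ.* (m ℕ.* m)         ≤⟨ ℕ.*-monoʳ-≤ 4 m²≤4[1+k] ⟩
    4 ℕ.* (4 ℕ.* suc k)     ≡⟨ ℕ.*-assoc 4 4 (suc k) ⟨
    16 ℕ.* suc k            ∎

lemma2 :
    -- (1) reduction of any ruler mod d is a cyclic ruler
    (∀ (d : ℕ) .{{_ : NonZero d}} (k : ℕ) (a c : ℤ) → k ≤ d → Coprime a (+ d) →
       (Q : List ℤ) → IsRuler a c k Q → IsCyclicRuler d a c k (reduce d Q))
    ×
    -- (2) rulers of size O(√k) exist (|Q|² ≤ C·(k+1)), absolute constant C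
    (∃[ C ] ∀ (d : ℕ) .{{_ : NonZero d}} (k : ℕ) (a c : ℤ) → k ≤ d → Coprime a (+ d) →
       ∃[ Q ] (IsRuler a c k Q
               × length Q ℕ.* length Q ≤ C ℕ.* suc k
               × length (reduce d Q) ℕ.* length (reduce d Q) ≤ C ℕ.* suc k))
lemma2 =
    (λ d k a c _ _ → reduce-isCyclicRuler d k a c)
  , 16 , λ d k a c _ _ →
      let Q , isRuler , size = small-ruler a c k
      in Q , isRuler , size , subst (λ L → L ℕ.* L ≤ 16 ℕ.* suc k) (sym (length-map _ Q)) size
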